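{- There exist polynomials $\xi,\eta,a_1,a_2,a_3,a_4,a_6\in\mathbb{Z}[a_{ij}]$ such that: (i) $c_4=b_2^2-24b_4$ and $c_6=-b_2^3+36b_2b_4-216b_6$, where $b_2=a_1^2+4a_2$, $b_4=a_1a_3+2a_4$ and $b_6=a_3^2+4a_6$; (ii) the polynomials $u=12\xi+a_1^2+4a_2$ and $v=2\eta+a_1\xi+a_3$ are invariants of weights $2$ and $3$, respectively, satisfying $(108v)^2=(3u)^3-27c_4(3u)-54c_6$; (iii) $\eta^2+a_1\xi\eta+a_3\eta=\xi^3+a_2\xi^2+a_4\xi+a_6$.
   Context: A $(2,2)$-form is $F=\sum_{i,j=1}^3 a_{ij}m_in_j$, where $(m_1,m_2,m_3)=(x_1^2,x_1x_2,x_2^2)$, $(n_1,n_2,n_3)=(y_1^2,y_1y_2,y_2^2)$, and the $a_{ij}$ are indeterminates. Invariants of $F$. - Write $F=F_1y_1^2+F_2y_1y_2+F_3y_2^2$ and $G_1=F_2^2-4F_1F_3$. - For a binary quartic $ax^4+bx^3y+cx^2y^2+dxy^3+ey^4$ put $I=12ae-3bd+c^2$ and $J=72ace-27ad^2-27b^2e+9bcd-2c^3$. - Then $c_4=I(G_1)$ and $c_6=J(G_1)/2$, as elements of $\mathbb{Z}[a_{ij}]$. Group action and invariants. - $\mathbb{C}^\times\times GL_2(\mathbb{C})\times GL_2(\mathbb{C})$ acts by $[\lambda,A,B]\cdot F=\lambda F((x_1,x_2)A;(y_1,y_2)B)$. - A polynomial $I\in\mathbb{Z}[a_{ij}]$ is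 an invariant of weight $p$ if $I([\lambda,A,B]\cdot F)=(\lambda\det A\det B)^pI(F)$ for all $[\lambda,A,B]$ in this group and all complex $F$. -}

module Defs where

open import Level using (0ℓ; Level) renaming (suc to lsuc)
open import Algebra.Bundles using (CommutativeRing)
open import Data.Nat using (ℕ; zero; suc)
open import Data.Fin using (Fin; zero; suc)
open import Data.Product using (∃; _×_; _,_)

-- Polynomials in ℤ[a_ij] (i,j ∈ {1,2,3}, indexed by Fin 3 with zero = 1)
-- as syntax; equality is equality in the free commutative ring, i.e.
-- equal evaluation in every commutative ring (see _≈ₚ_ below).

infixl 6 _⊕_ _⊖_
infixl 7 _⊗_
infixr 8 _⊛_
infixr 9 _^_
infix 10 ⊝_
infix 4 _≈ₚ_

data Poly : Set where
  con : ℕ → Poly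
  var : Fin 3 → Fin 3 → Poly       -- var i j = a_{i+1,j+1}
  _⊕_ : Poly → Poly → Poly
  _⊗_ : Poly → Poly → Poly
  ⊝_  : Poly → Poly

_⊖_ : Poly → Poly → Poly
p ⊖ q = p ⊕ (⊝ q)

_⊛_ : ℕ → Poly → Poly
k ⊛ p = con k ⊗ p

_^_ : Poly → ℕ → Poly
p ^ zero  = con 1
p ^ suc n = p ⊗ (p ^ n)

CRing : Set₁
CRing = CommutativeRing 0ℓ 0ℓ

module Eval (R : CRing) where
  open CommutativeRing R using (Carrier; _≈_; _+_; _*_; -_; _-_; 0#; 1#)

  Assignment : Set
  Assignment = Fin 3 → Fin 3 → Carrier

  Mat2 : Set
  Mat2 = Fin 2 → Fin 2 → Carrier

  natR : ℕ → Carrier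
  natR zero    = 0#
  natR (suc n) = 1# + natR n

  powR : Carrier → ℕ → Carrier
  powR x zero    = 1#
  powR x (suc n) = x * powR x n

  ⟦_⟧ : Poly → Assignment → Carrier
  ⟦ con n ⟧   ρ = natR n
  ⟦ var i j ⟧ ρ = ρ i j
  ⟦ p ⊕ q ⟧   ρ = ⟦ p ⟧ ρ + ⟦ q ⟧ ρ
  ⟦ p ⊗ q ⟧   ρ = ⟦ p ⟧ ρ * ⟦ q ⟧ ρ
  ⟦ ⊝ p ⟧     ρ = - ⟦ p ⟧ ρ

  IsUnit : Carrier → Set
  IsUnit x = ∃ λ y → x * y ≈ 1#

  -- A = (A i j), rows i, columns j (zero = 1)
  det : Mat2 → Carrier
  det A = A zero zero * A (suc zero) (suc zero) - A zero (suc zero) * A (suc zero) zero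

  -- Induced action on quadratic monomials (m1,m2,m3) = (x1², x1x2, x2²):
  -- with (x1',x2') = (x1,x2)A, i.e. x1' = A11 x1 + A21 x2, x2' = A12 x1 + A22 x2,
  -- m'_i = Σ_k Sym2 A i k · m_k.
  Sym2 : Mat2 → Fin 3 → Fin 3 → Carrier
  Sym2 A i k = go i k
    where
    a11 = A zero zero
    a12 = A zero (suc zero)
    a21 = A (suc zero) zero
    a22 = A (suc zero) (suc zero)
    go : Fin 3 → Fin 3 → Carrier
    go zero zero = a11 * a11
    go zero (suc zero) = (1# + 1#) * (a11 * a21)
    go zero (suc (suc zero)) = a21 * a21
    go (suc zero) zero = a11 * a12
    go (suc zero) (suc zero) = a11 * a22 + a21 * a12
    go (suc zero) (suc (suc zero)) = a21 * a22
    go (suc (suc zero)) zero = a12 * a12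
    go (suc (suc zero)) (suc zero) = (1# + 1#) * (a12 * a22)
    go (suc (suc zero)) (suc (suc zero)) = a22 * a22

  sum3 : (Fin 3 → Carrier) → Carrier
  sum3 f = f zero + f (suc zero) + f (suc (suc zero))

  -- coefficients of [t,A,B]·F = t F((x1,x2)A ; (y1,y2)B):
  -- a'_kl = t Σ_{i,j} Sym2 A i k · a_ij · Sym2 B j l
  act : Carrier → Mat2 → Mat2 → Assignment → Assignment
  act t A B ρ k l = t * sum3 (λ i → sum3 (λ j → Sym2 A i k * ρ i j * Sym2 B j l))

_≈ₚ_ : Poly → Poly → Set₁
p ≈ₚ q = (R : CRing) (ρ : Eval.Assignment R) →
         CommutativeRing._≈_ R (Eval.⟦_⟧ R p ρ) (Eval.⟦_⟧ R q ρ)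

Invariant : ℕ → Poly → Set₁
Invariant w P = (R : CRing) →
  let open CommutativeRing R using (Carrier; _≈_; _*_); open Eval R in
  (t : Carrier) (A B : Mat2) (ρ : Assignment) →
  IsUnit t → IsUnit (det A) → IsUnit (det B) →
  ⟦ P ⟧ (act t A B ρ) ≈ powR (t * det A * det B) w * ⟦ P ⟧ ρ

a : Fin 3 → Fin 3 → Poly
a = var

-- F = F1 y1² + F2 y1y2 + F3 y2², F_j = Σ_i a_ij m_i ; coefficient of m_i in F_j:
f : Fin 3 → Fin 3 → Poly
f j i = a i j

private
  z o w : Fin 3
  z = zero
  o = suc zero
  w = suc (suc zero)

-- G1 = F2² − 4 F1 F3 as a binary quartic g0 x1⁴ + g1 x1³x2 + g2 x1²x2² + g3 x1x2³ + g4 x2⁴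
g0 g1 g2 g3 g4 : Poly
g0 = f o z ⊗ f o z ⊖ 4 ⊛ (f z z ⊗ f w z)
g1 = 2 ⊛ (f o z ⊗ f o o) ⊖ 4 ⊛ (f z z ⊗ f w o ⊕ f z o ⊗ f w z)
g2 = 2 ⊛ (f o z ⊗ f o w) ⊕ f o o ⊗ f o o ⊖ 4 ⊛ (f z z ⊗ f w w ⊕ f z o ⊗ f w o ⊕ f z w ⊗ f w z)
g3 = 2 ⊛ (f o o ⊗ f o w) ⊖ 4 ⊛ (f z o ⊗ f w w ⊕ f z w ⊗ f w o)
g4 = f o w ⊗ f o w ⊖ 4 ⊛ (f z w ⊗ f w w)

-- g1 = 2 g1h and g3 = 2 g3h
g1h g3h : Poly
g1h = f o z ⊗ f o o ⊖ 2 ⊛ (f z z ⊗ f w o ⊕ f z o ⊗ f w z)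
g3h = f o o ⊗ f o w ⊖ 2 ⊛ (f z o ⊗ f w w ⊕ f z w ⊗ f w o)

Iq : Poly → Poly → Poly → Poly → Poly → Poly
Iq a' b c d e = 12 ⊛ (a' ⊗ e) ⊖ 3 ⊛ (b ⊗ d) ⊕ c ^ 2

Jq : Poly → Poly → Poly → Poly → Poly → Poly
Jq a' b c d e = 72 ⊛ (a' ⊗ c ⊗ e) ⊖ 27 ⊛ (a' ⊗ d ^ 2) ⊖ 27 ⊛ (b ^ 2 ⊗ e)
              ⊕ 9 ⊛ (b ⊗ c ⊗ d) ⊖ 2 ⊛ (c ^ 3)

c4 : Poly
c4 = Iq g0 g1 g2 g3 g4

-- c6 = J(G1)/2, written out with b = 2 g1h, d = 2 g3h, so that
-- 2 ⊛ c6 is literally Jq g0 (2 g1h) g2 (2 g3h) g4 after expansion.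
c6 : Poly
c6 = 36 ⊛ (g0 ⊗ g2 ⊗ g4) ⊖ 54 ⊛ (g0 ⊗ g3h ^ 2) ⊖ 54 ⊛ (g1h ^ 2 ⊗ g4)
     ⊕ 18 ⊛ (g1h ⊗ g2 ⊗ g3h) ⊖ g2 ^ 3

{-# OPTIONS --safe #-}
-- Every claim is an identity of integer polynomials: in the a_ij, and for the invariance
-- claims also in t and the entries of A and B.  Such identities hold in every commutative
-- ring iff the normal forms agree.  A polynomial is encoded as a formal difference p⁺ − p⁻
-- of negation-free expressions, so that the ring solver's sparse Horner forms with natural
-- coefficients can decide p = q as p⁺ + q⁻ = q⁺ + p⁻.  For invariance the action is
-- factored as F ↦ t · (A acting on the row index, B on the column index), and each factor
-- is checked separately to contribute t^w, (det A)^w and (det B)^w.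
module Submission where

open import Defs
open import Data.Product using (∃; _×_)

open import Level using (0ℓ)
open import Algebra.Bundles using (CommutativeRing)
open import Data.Fin.Base using (Fin; zero; suc; combine; remQuot; _↑ʳ_)
open import Data.Fin.Properties using (remQuot-combine)
open import Data.Maybe.Base using (nothing)
open import Data.Nat.Base as ℕ using (ℕ; zero; suc)
open import Data.Product using (_,_; uncurry)
open import Data.Vec.Base using (Vec; []; _∷_; lookup; tabulate; _++_)
open import Data.Vec.Properties using (lookup∘tabulate; lookup-++ʳ)
open import Function.Base using (id; _∘_)
open import Relation.Binary.PropositionalEquality as ≡ using (_≡_)
open import Tactic.RingSolver using (solve-∀)
open import Tactic.RingSolver.Core.AlmostCommutativeRing
  using (AlmostCommutativeRing; fromCommutativeRing; fromCommutativeSemiring)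
open import Tactic.RingSolver.Core.Polynomial.Parameters using (RawCoeff; Homomorphism)
import Tactic.RingSolver.Core.Polynomial.Base as HornerBase
import Tactic.RingSolver.Core.Polynomial.Semantics as HornerSemantics
import Tactic.RingSolver.Core.Polynomial.Homomorphism as HornerHomomorphism
import Algebra.Properties.Semiring.Mult.TCOptimised as Multiples
import Algebra.Properties.CommutativeSemigroup as CommutativeSemigroupProperties
import Relation.Binary.Reasoning.Setoid as SetoidReasoning

ℕ-coefficients : RawCoeff 0ℓ 0ℓ
ℕ-coefficients = record
  { rawRing = record
    { Carrier = ℕ ; _≈_ = _≡_ ; _+_ = ℕ._+_ ; _*_ = ℕ._*_ ; -_ = id ; 0# = 0 ; 1# = 1 }
  ; isZero  = ℕ._≡ᵇ 0
  }

open HornerBase ℕ-coefficients using (κ; ι; _⊞_; _⊠_) renaming (Poly to Horner)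

infixl 6 _:+_
infixl 7 _:*_

data NatExpr (n : ℕ) : Set where
  lit  : ℕ → NatExpr n
  arg  : Fin n → NatExpr n
  _:+_ : NatExpr n → NatExpr n → NatExpr n
  _:*_ : NatExpr n → NatExpr n → NatExpr n

normalise : ∀ {n} → NatExpr n → Horner n
normalise (lit c)  = κ c
normalise (arg i)  = ι i
normalise (e :+ f) = normalise e ⊞ normalise f
normalise (e :* f) = normalise e ⊠ normalise f

Difference : ℕ → Set
Difference n = NatExpr n × NatExpr n

infixl 6 _+ᵈ_
infixl 7 _*ᵈ_
infixr 8 _^ᵈ_

embed : ∀ {n} → NatExpr n → Difference n
embed e = e , lit 0

_+ᵈ_ _*ᵈ_ : ∀ {n} → Difference n → Difference n → Difference n
(p⁺ , p⁻) +ᵈ (q⁺ , q⁻) = p⁺ :+ q⁺ , p⁻ :+ q⁻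
(p⁺ , p⁻) *ᵈ (q⁺ , q⁻) = p⁺ :* q⁺ :+ p⁻ :* q⁻ , p⁺ :* q⁻ :+ p⁻ :* q⁺

-ᵈ_ : ∀ {n} → Difference n → Difference n
-ᵈ (p⁺ , p⁻) = p⁻ , p⁺

_^ᵈ_ : ∀ {n} → Difference n → ℕ → Difference n
d ^ᵈ zero  = embed (lit 1)
d ^ᵈ suc w = d *ᵈ d ^ᵈ w

Balanced : ∀ {n} → Difference n → Difference n → Set
Balanced (p⁺ , p⁻) (q⁺ , q⁻) = normalise (p⁺ :+ q⁻) ≡ normalise (q⁺ :+ p⁻)

substitute : ∀ {n} → (Fin 3 → Fin 3 → Difference n) → Poly → Difference n
substitute σ (con c)   = embed (lit c)
substitute σ (var i j) = σ i j
substitute σ (p ⊕ q)   = substitute σ p +ᵈ substitute σ q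
substitute σ (p ⊗ q)   = substitute σ p *ᵈ substitute σ q
substitute σ (⊝ p)     = -ᵈ substitute σ p

coefficientEnv : {A : Set} → (Fin 3 → Fin 3 → A) → Vec A 9
coefficientEnv α = tabulate (uncurry α ∘ remQuot 3)

lookup-coefficientEnv : {A : Set} (α : Fin 3 → Fin 3 → A) (i j : Fin 3) →
                        lookup (coefficientEnv α) (combine i j) ≡ α i j
lookup-coefficientEnv α i j =
  ≡.trans (lookup∘tabulate (uncurry α ∘ remQuot 3) (combine i j))
          (≡.cong (uncurry α) (remQuot-combine i j))

coefficient : ∀ m → Fin 3 → Fin 3 → NatExpr (m ℕ.+ 9)
coefficient m i j = arg (m ↑ʳ combine i j)

sum3ₑ : ∀ {n} → (Fin 3 → NatExpr n) → NatExpr n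
sum3ₑ f = f zero :+ f (suc zero) :+ f (suc (suc zero))

-- Variables 0–3 are the entries of a 2 × 2 matrix, the remaining nine the coefficients.
m₁₁ m₁₂ m₂₁ m₂₂ : NatExpr (4 ℕ.+ 9)
m₁₁ = arg zero
m₁₂ = arg (suc zero)
m₂₁ = arg (suc (suc zero))
m₂₂ = arg (suc (suc (suc zero)))

sym2ₑ : Fin 3 → Fin 3 → NatExpr (4 ℕ.+ 9)
sym2ₑ zero             zero             = m₁₁ :* m₁₁
sym2ₑ zero             (suc zero)       = (lit 1 :+ lit 1) :* (m₁₁ :* m₂₁)
sym2ₑ zero             (suc (suc zero)) = m₂₁ :* m₂₁
sym2ₑ (suc zero)       zero             = m₁₁ :* m₁₂
sym2ₑ (suc zero)       (suc zero)       = m₁₁ :* m₂₂ :+ m₂₁ :* m₁₂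
sym2ₑ (suc zero)       (suc (suc zero)) = m₂₁ :* m₂₂
sym2ₑ (suc (suc zero)) zero             = m₁₂ :* m₁₂
sym2ₑ (suc (suc zero)) (suc zero)       = (lit 1 :+ lit 1) :* (m₁₂ :* m₂₂)
sym2ₑ (suc (suc zero)) (suc (suc zero)) = m₂₂ :* m₂₂

detᵈ : Difference (4 ℕ.+ 9)
detᵈ = m₁₁ :* m₂₂ , m₁₂ :* m₂₁

coefficientᵈ : ∀ m → Fin 3 → Fin 3 → Difference (m ℕ.+ 9)
coefficientᵈ m i j = embed (coefficient m i j)

scaledᵈ : Fin 3 → Fin 3 → Difference (1 ℕ.+ 9)
scaledᵈ i j = embed (arg zero :* coefficient 1 i j)

rowActionᵈ columnActionᵈ : Fin 3 → Fin 3 → Difference (4 ℕ.+ 9)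
rowActionᵈ    k l = embed (sum3ₑ (λ i → sym2ₑ i k :* coefficient 4 i l))
columnActionᵈ i l = embed (sum3ₑ (λ j → coefficient 4 i j :* sym2ₑ j l))

module CommutativeRingIdentities (R : CRing) where
  almostCommutativeRing : AlmostCommutativeRing 0ℓ 0ℓ
  almostCommutativeRing = fromCommutativeRing R (λ _ → nothing)
  open AlmostCommutativeRing almostCommutativeRing

  *-difference : ∀ x y a b → x * y + ((x + a) * b + a * (y + b)) ≈ (x + a) * (y + b) + a * b
  *-difference = solve-∀ almostCommutativeRing

module Action (R : CRing) where
  open CommutativeRing R hiding (zero)
  open Eval R
  open SetoidReasoning setoid

  scale : Carrier → Assignment → Assignment
  scale t α i j = t * α i j

  rowAction columnAction : Mat2 → Assignment → Assignment
  rowAction    A α k l = sum3 (λ i → Sym2 A i k * α i l)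
  columnAction B α i l = sum3 (λ j → α i j * Sym2 B j l)

  sum3-cong : ∀ {f g : Fin 3 → Carrier} → (∀ i → f i ≈ g i) → sum3 f ≈ sum3 g
  sum3-cong f≈g = +-cong (+-cong (f≈g zero) (f≈g (suc zero))) (f≈g (suc (suc zero)))

  *-distribˡ-sum3 : ∀ x (f : Fin 3 → Carrier) → x * sum3 f ≈ sum3 (λ i → x * f i)
  *-distribˡ-sum3 x f =
    trans (distribˡ x (f zero + f (suc zero)) _) (+-congʳ (distribˡ x (f zero) (f (suc zero))))

  act-factorises : ∀ t A B α k l → act t A B α k l ≈ scale t (rowAction A (columnAction B α)) k l
  act-factorises t A B α k l = *-congˡ (sum3-cong λ i → begin
    sum3 (λ j → Sym2 A i k * α i j * Sym2 B j l)
      ≈⟨ sum3-cong (λ j → *-assoc (Sym2 A i k) (α i j) (Sym2 B j l)) ⟩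
    sum3 (λ j → Sym2 A i k * (α i j * Sym2 B j l))
      ≈⟨ *-distribˡ-sum3 (Sym2 A i k) (λ j → α i j * Sym2 B j l) ⟨
    Sym2 A i k * sum3 (λ j → α i j * Sym2 B j l)
      ∎)

  powR-distrib-* : ∀ x y w → powR (x * y) w ≈ powR x w * powR y w
  powR-distrib-* x y zero    = sym (*-identityʳ 1#)
  powR-distrib-* x y (suc w) =
    trans (*-congˡ (powR-distrib-* x y w)) (interchange x y (powR x w) (powR y w))
    where open CommutativeSemigroupProperties *-commutativeSemigroup using (interchange)

  ⟦⟧-cong : ∀ p {α β : Assignment} → (∀ i j → α i j ≈ β i j) → ⟦ p ⟧ α ≈ ⟦ p ⟧ β
  ⟦⟧-cong (con c)   α≈β = refl
  ⟦⟧-cong (var i j) α≈β = α≈β i j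
  ⟦⟧-cong (p ⊕ q)   α≈β = +-cong (⟦⟧-cong p α≈β) (⟦⟧-cong q α≈β)
  ⟦⟧-cong (p ⊗ q)   α≈β = *-cong (⟦⟧-cong p α≈β) (⟦⟧-cong q α≈β)
  ⟦⟧-cong (⊝ p)     α≈β = -‿cong (⟦⟧-cong p α≈β)

module Soundness (R : CRing) where
  open CommutativeRing R hiding (zero)
  open Eval R using (⟦_⟧; natR; powR; Assignment; Mat2; Sym2; det)
  open Action R using (scale; rowAction; columnAction; sum3-cong)
  open Multiples semiring using (×-homo-+; ×1-homo-*; ×ᵤ≈×) renaming (_×_ to _×′_)
  open import Algebra.Definitions.RawMonoid +-rawMonoid using () renaming (_×_ to _×ᵤ_)
  open import Algebra.Properties.Group +-group using (\\-leftDividesʳ; //-rightDividesˡ; ∙-cancelʳ)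
  open SetoidReasoning setoid

  open CommutativeRingIdentities R using (*-difference)
  open CommutativeSemigroupProperties +-commutativeSemigroup using () renaming (interchange to +-interchange)

  ℕ⟶R : Homomorphism 0ℓ 0ℓ 0ℓ 0ℓ
  ℕ⟶R = record
    { from          = ℕ-coefficients
    ; to            = fromCommutativeSemiring commutativeSemiring (λ _ → nothing)
    ; morphism      = record
      { ⟦_⟧ = _×′ 1# ; +-homo = ×-homo-+ 1# ; *-homo = ×1-homo-*
      ; -‿homo = λ _ → refl ; 0-homo = refl ; 1-homo = refl }
    ; Zero-C⟶Zero-R = λ { zero _ → refl }
    }

  open HornerSemantics ℕ⟶R using () renaming (⟦_⟧ to ⟦_⟧ₕ)
  open HornerHomomorphism ℕ⟶R using (κ-hom; ι-hom; ⊞-hom; ⊠-hom)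

  ⟦_⟧ₑ : ∀ {n} → NatExpr n → Vec Carrier n → Carrier
  ⟦ lit c ⟧ₑ  ρ = c ×′ 1#
  ⟦ arg i ⟧ₑ  ρ = lookup ρ i
  ⟦ e :+ f ⟧ₑ ρ = ⟦ e ⟧ₑ ρ + ⟦ f ⟧ₑ ρ
  ⟦ e :* f ⟧ₑ ρ = ⟦ e ⟧ₑ ρ * ⟦ f ⟧ₑ ρ

  normalise-sound : ∀ {n} (e : NatExpr n) ρ → ⟦ normalise e ⟧ₕ ρ ≈ ⟦ e ⟧ₑ ρ
  normalise-sound (lit c)  ρ = κ-hom c ρ
  normalise-sound (arg i)  ρ = ι-hom i ρ
  normalise-sound (e :+ f) ρ =
    trans (⊞-hom (normalise e) (normalise f) ρ) (+-cong (normalise-sound e ρ) (normalise-sound f ρ))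
  normalise-sound (e :* f) ρ =
    trans (⊠-hom (normalise e) (normalise f) ρ) (*-cong (normalise-sound e ρ) (normalise-sound f ρ))

  normalise-≡⇒≈ : ∀ {n} (e f : NatExpr n) ρ → normalise e ≡ normalise f → ⟦ e ⟧ₑ ρ ≈ ⟦ f ⟧ₑ ρ
  normalise-≡⇒≈ e f ρ e≡f =
    trans (sym (normalise-sound e ρ))
          (trans (reflexive (≡.cong (λ h → ⟦ h ⟧ₕ ρ) e≡f)) (normalise-sound f ρ))

  natR≈×′ : ∀ c → natR c ≈ c ×′ 1#
  natR≈×′ c = trans (natR≈×ᵤ c) (×ᵤ≈× c 1#)
    where
    natR≈×ᵤ : ∀ c → natR c ≈ c ×ᵤ 1#
    natR≈×ᵤ zero    = refl
    natR≈×ᵤ (suc c) = +-congˡ (natR≈×ᵤ c)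

  Represents : ∀ {n} → Carrier → Difference n → Vec Carrier n → Set
  Represents x (p⁺ , p⁻) ρ = x + ⟦ p⁻ ⟧ₑ ρ ≈ ⟦ p⁺ ⟧ₑ ρ

  represents-embed : ∀ {n x} (e : NatExpr n) ρ → x ≈ ⟦ e ⟧ₑ ρ → Represents x (embed e) ρ
  represents-embed e ρ x≈e = trans (+-identityʳ _) x≈e

  module _ {n} {ρ : Vec Carrier n} where

    represents-+ : ∀ {x y} d e → Represents x d ρ → Represents y e ρ → Represents (x + y) (d +ᵈ e) ρ
    represents-+ {x} {y} (p⁺ , p⁻) (q⁺ , q⁻) x~d y~e =
      trans (+-interchange x y (⟦ p⁻ ⟧ₑ ρ) (⟦ q⁻ ⟧ₑ ρ)) (+-cong x~d y~e)

    represents-* : ∀ {x y} d e → Represents x d ρ → Represents y e ρ → Represents (x * y) (d *ᵈ e) ρ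
    represents-* {x} {y} (p⁺ , p⁻) (q⁺ , q⁻) x~d y~e = begin
      x * y + (P⁺ * Q⁻ + P⁻ * Q⁺)              ≈⟨ +-congˡ (+-cong (*-congʳ x~d) (*-congˡ y~e)) ⟨
      x * y + ((x + P⁻) * Q⁻ + P⁻ * (y + Q⁻))  ≈⟨ *-difference x y P⁻ Q⁻ ⟩
      (x + P⁻) * (y + Q⁻) + P⁻ * Q⁻            ≈⟨ +-congʳ (*-cong x~d y~e) ⟩
      P⁺ * Q⁺ + P⁻ * Q⁻                        ∎
      where
      P⁺ = ⟦ p⁺ ⟧ₑ ρ
      P⁻ = ⟦ p⁻ ⟧ₑ ρ
      Q⁺ = ⟦ q⁺ ⟧ₑ ρ
      Q⁻ = ⟦ q⁻ ⟧ₑ ρ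

    represents-neg : ∀ {x} d → Represents x d ρ → Represents (- x) (-ᵈ d) ρ
    represents-neg {x} (p⁺ , p⁻) x~d = trans (+-congˡ (sym x~d)) (\\-leftDividesʳ x (⟦ p⁻ ⟧ₑ ρ))

    represents-^ : ∀ {x} d → Represents x d ρ → ∀ w → Represents (powR x w) (d ^ᵈ w) ρ
    represents-^ d x~d zero    = represents-embed (lit 1) ρ refl
    represents-^ d x~d (suc w) = represents-* d (d ^ᵈ w) x~d (represents-^ d x~d w)

    represents-substitute : ∀ {α : Assignment} {σ : Fin 3 → Fin 3 → Difference n} →
      (∀ i j → Represents (α i j) (σ i j) ρ) → ∀ p → Represents (⟦ p ⟧ α) (substitute σ p) ρ
    represents-substitute α~σ (con c)   = represents-embed (lit c) ρ (natR≈×′ c)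
    represents-substitute α~σ (var i j) = α~σ i j
    represents-substitute {σ = σ} α~σ (p ⊕ q) =
      represents-+ (substitute σ p) (substitute σ q)
        (represents-substitute α~σ p) (represents-substitute α~σ q)
    represents-substitute {σ = σ} α~σ (p ⊗ q) =
      represents-* (substitute σ p) (substitute σ q)
        (represents-substitute α~σ p) (represents-substitute α~σ q)
    represents-substitute {σ = σ} α~σ (⊝ p) =
      represents-neg (substitute σ p) (represents-substitute α~σ p)

    balanced⇒≈ : ∀ {x y} d e → Represents x d ρ → Represents y e ρ → Balanced d e → x ≈ y
    balanced⇒≈ {x} {y} (p⁺ , p⁻) (q⁺ , q⁻) x~d y~e d≋e = ∙-cancelʳ (P⁻ + Q⁻) x y (begin
      x + (P⁻ + Q⁻)  ≈⟨ sym (+-assoc x P⁻ Q⁻) ⟩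
      x + P⁻ + Q⁻    ≈⟨ +-congʳ x~d ⟩
      P⁺ + Q⁻        ≈⟨ normalise-≡⇒≈ (p⁺ :+ q⁻) (q⁺ :+ p⁻) ρ d≋e ⟩
      Q⁺ + P⁻        ≈⟨ +-congʳ y~e ⟨
      y + Q⁻ + P⁻    ≈⟨ +-assoc y Q⁻ P⁻ ⟩
      y + (Q⁻ + P⁻)  ≈⟨ +-congˡ (+-comm Q⁻ P⁻) ⟩
      y + (P⁻ + Q⁻)  ∎)
      where
      P⁺ = ⟦ p⁺ ⟧ₑ ρ
      P⁻ = ⟦ p⁻ ⟧ₑ ρ
      Q⁺ = ⟦ q⁺ ⟧ₑ ρ
      Q⁻ = ⟦ q⁻ ⟧ₑ ρ

  coefficient-sound : ∀ {m} (xs : Vec Carrier m) (α : Assignment) i j →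
                      ⟦ coefficient m i j ⟧ₑ (xs ++ coefficientEnv α) ≡ α i j
  coefficient-sound xs α i j =
    ≡.trans (lookup-++ʳ xs (coefficientEnv α) (combine i j)) (lookup-coefficientEnv α i j)

  represents-coefficient : ∀ {m} (xs : Vec Carrier m) (α : Assignment) i j →
                           Represents (α i j) (coefficientᵈ m i j) (xs ++ coefficientEnv α)
  represents-coefficient {m} xs α i j =
    represents-embed (coefficient m i j) (xs ++ coefficientEnv α)
      (reflexive (≡.sym (coefficient-sound xs α i j)))

  represents-scaled : ∀ t α i j → Represents (scale t α i j) (scaledᵈ i j) (t ∷ coefficientEnv α)
  represents-scaled t α i j =
    represents-embed (arg zero :* coefficient 1 i j) (t ∷ coefficientEnv α)
      (*-congˡ (reflexive (≡.sym (coefficient-sound (t ∷ []) α i j))))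

  matrixEntries : Mat2 → Vec Carrier 4
  matrixEntries A = A zero zero ∷ A zero (suc zero) ∷ A (suc zero) zero ∷ A (suc zero) (suc zero) ∷ []

  matrixEnv : Mat2 → Assignment → Vec Carrier (4 ℕ.+ 9)
  matrixEnv A α = matrixEntries A ++ coefficientEnv α

  sym2ₑ-sound : ∀ A α i k → ⟦ sym2ₑ i k ⟧ₑ (matrixEnv A α) ≡ Sym2 A i k
  sym2ₑ-sound A α zero             zero             = ≡.refl
  sym2ₑ-sound A α zero             (suc zero)       = ≡.refl
  sym2ₑ-sound A α zero             (suc (suc zero)) = ≡.refl
  sym2ₑ-sound A α (suc zero)       zero             = ≡.refl
  sym2ₑ-sound A α (suc zero)       (suc zero)       = ≡.refl
  sym2ₑ-sound A α (suc zero)       (suc (suc zero)) = ≡.refl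
  sym2ₑ-sound A α (suc (suc zero)) zero             = ≡.refl
  sym2ₑ-sound A α (suc (suc zero)) (suc zero)       = ≡.refl
  sym2ₑ-sound A α (suc (suc zero)) (suc (suc zero)) = ≡.refl

  represents-det : ∀ A α → Represents (det A) detᵈ (matrixEnv A α)
  represents-det A α =
    //-rightDividesˡ (A zero (suc zero) * A (suc zero) zero) (A zero zero * A (suc zero) (suc zero))

  represents-rowAction : ∀ A α k l → Represents (rowAction A α k l) (rowActionᵈ k l) (matrixEnv A α)
  represents-rowAction A α k l =
    represents-embed (sum3ₑ term) env (sum3-cong {g = λ i → ⟦ term i ⟧ₑ env} λ i →
      *-cong (reflexive (≡.sym (sym2ₑ-sound A α i k)))
             (reflexive (≡.sym (coefficient-sound (matrixEntries A) α i l))))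
    where
    env  = matrixEnv A α
    term = λ i → sym2ₑ i k :* coefficient 4 i l

  represents-columnAction : ∀ B α i l → Represents (columnAction B α i l) (columnActionᵈ i l) (matrixEnv B α)
  represents-columnAction B α i l =
    represents-embed (sum3ₑ term) env (sum3-cong {g = λ j → ⟦ term j ⟧ₑ env} λ j →
      *-cong (reflexive (≡.sym (coefficient-sound (matrixEntries B) α i j)))
             (reflexive (≡.sym (sym2ₑ-sound B α j l))))
    where
    env  = matrixEnv B α
    term = λ j → coefficient 4 i j :* sym2ₑ j l

  module _ {n} {ρ : Vec Carrier n} where

    scales-by-normalisation :
      ∀ {α β : Assignment} {σ τ : Fin 3 → Fin 3 → Difference n} {x} d w p →
      (∀ i j → Represents (α i j) (σ i j) ρ) → (∀ i j → Represents (β i j) (τ i j) ρ) → Represents x d ρ →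
      Balanced (substitute σ p) (d ^ᵈ w *ᵈ substitute τ p) → ⟦ p ⟧ α ≈ powR x w * ⟦ p ⟧ β
    scales-by-normalisation {σ = σ} {τ} d w p α~σ β~τ x~d =
      balanced⇒≈ (substitute σ p) (d ^ᵈ w *ᵈ substitute τ p) (represents-substitute α~σ p)
        (represents-* (d ^ᵈ w) (substitute τ p) (represents-^ d x~d w) (represents-substitute β~τ p))

Homogeneous RowInvariant ColumnInvariant : ℕ → Poly → Set₁
Homogeneous w p = (R : CRing) →
  let open CommutativeRing R using (_≈_; _*_); open Eval R; open Action R in
  ∀ t α → ⟦ p ⟧ (scale t α) ≈ powR t w * ⟦ p ⟧ α
RowInvariant w p = (R : CRing) →
  let open CommutativeRing R using (_≈_; _*_); open Eval R; open Action R in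
  ∀ A α → ⟦ p ⟧ (rowAction A α) ≈ powR (det A) w * ⟦ p ⟧ α
ColumnInvariant w p = (R : CRing) →
  let open CommutativeRing R using (_≈_; _*_); open Eval R; open Action R in
  ∀ B α → ⟦ p ⟧ (columnAction B α) ≈ powR (det B) w * ⟦ p ⟧ α

-- The identities are polynomial.
invariant : ∀ w p → Homogeneous w p → RowInvariant w p → ColumnInvariant w p → Invariant w p
invariant w p homogeneous row column R t A B α _ _ _ = begin
  ⟦ p ⟧ (act t A B α)                                            ≈⟨ ⟦⟧-cong p (act-factorises t A B α) ⟩
  ⟦ p ⟧ (scale t (rowAction A (columnAction B α)))               ≈⟨ homogeneous R t _ ⟩
  powR t w * ⟦ p ⟧ (rowAction A (columnAction B α))              ≈⟨ *-congˡ (row R A _) ⟩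
  powR t w * (powR (det A) w * ⟦ p ⟧ (columnAction B α))         ≈⟨ *-congˡ (*-congˡ (column R B α)) ⟩
  powR t w * (powR (det A) w * (powR (det B) w * ⟦ p ⟧ α))       ≈⟨ trans (*-assoc _ _ _) (*-assoc _ _ _) ⟨
  powR t w * powR (det A) w * powR (det B) w * ⟦ p ⟧ α           ≈⟨ *-congʳ powR-distrib ⟨
  powR (t * det A * det B) w * ⟦ p ⟧ α                           ∎
  where
  open CommutativeRing R hiding (zero)
  open Eval R using (⟦_⟧; act; det; powR)
  open Action R
  open SetoidReasoning setoid

  powR-distrib : powR (t * det A * det B) w ≈ powR t w * powR (det A) w * powR (det B) w
  powR-distrib = trans (powR-distrib-* (t * det A) (det B) w) (*-congʳ (powR-distrib-* t (det A) w))

≈ₚ-by-normalisation : ∀ p q →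
  Balanced (substitute (coefficientᵈ 0) p) (substitute (coefficientᵈ 0) q) → p ≈ₚ q
≈ₚ-by-normalisation p q p≋q R α =
  balanced⇒≈ {ρ = coefficientEnv α} (substitute (coefficientᵈ 0) p) (substitute (coefficientᵈ 0) q)
    (represents-substitute (represents-coefficient [] α) p)
    (represents-substitute (represents-coefficient [] α) q) p≋q
  where open Soundness R

homogeneous-by-normalisation : ∀ w p →
  Balanced (substitute scaledᵈ p) (embed (arg zero) ^ᵈ w *ᵈ substitute (coefficientᵈ 1) p) → Homogeneous w p
homogeneous-by-normalisation w p p≋ R t α =
  scales-by-normalisation {ρ = t ∷ coefficientEnv α} (embed (arg zero)) w p
    (represents-scaled t α) (represents-coefficient (t ∷ []) α)
    (represents-embed (arg zero) (t ∷ coefficientEnv α) (CommutativeRing.refl R)) p≋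
  where open Soundness R

rowInvariant-by-normalisation : ∀ w p →
  Balanced (substitute rowActionᵈ p) (detᵈ ^ᵈ w *ᵈ substitute (coefficientᵈ 4) p) → RowInvariant w p
rowInvariant-by-normalisation w p p≋ R A α =
  scales-by-normalisation {ρ = matrixEnv A α} detᵈ w p
    (represents-rowAction A α) (represents-coefficient (matrixEntries A) α) (represents-det A α) p≋
  where open Soundness R

columnInvariant-by-normalisation : ∀ w p →
  Balanced (substitute columnActionᵈ p) (detᵈ ^ᵈ w *ᵈ substitute (coefficientᵈ 4) p) → ColumnInvariant w p
columnInvariant-by-normalisation w p p≋ R B α =
  scales-by-normalisation {ρ = matrixEnv B α} detᵈ w p
    (represents-columnAction B α) (represents-coefficient (matrixEntries B) α) (represents-det B α) p≋
  where open Soundness R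

invariant-by-normalisation : ∀ w p →
  Balanced (substitute scaledᵈ p) (embed (arg zero) ^ᵈ w *ᵈ substitute (coefficientᵈ 1) p) →
  Balanced (substitute rowActionᵈ p) (detᵈ ^ᵈ w *ᵈ substitute (coefficientᵈ 4) p) →
  Balanced (substitute columnActionᵈ p) (detᵈ ^ᵈ w *ᵈ substitute (coefficientᵈ 4) p) → Invariant w p
invariant-by-normalisation w p scaled≋ row≋ column≋ = invariant w p
  (homogeneous-by-normalisation w p scaled≋)
  (rowInvariant-by-normalisation w p row≋)
  (columnInvariant-by-normalisation w p column≋)

a₁₁ a₁₂ a₁₃ a₂₁ a₂₂ a₂₃ a₃₁ a₃₂ a₃₃ : Poly
a₁₁ = a zero zero
a₁₂ = a zero (suc zero)
a₁₃ = a zero (suc (suc zero))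
a₂₁ = a (suc zero) zero
a₂₂ = a (suc zero) (suc zero)
a₂₃ = a (suc zero) (suc (suc zero))
a₃₁ = a (suc (suc zero)) zero
a₃₂ = a (suc (suc zero)) (suc zero)
a₃₃ = a (suc (suc zero)) (suc (suc zero))

det₃ : Poly
det₃ = a₁₁ ⊗ (a₂₂ ⊗ a₃₃ ⊖ a₂₃ ⊗ a₃₂) ⊖ a₁₂ ⊗ (a₂₁ ⊗ a₃₃ ⊖ a₂₃ ⊗ a₃₁) ⊕ a₁₃ ⊗ (a₂₁ ⊗ a₃₂ ⊖ a₂₂ ⊗ a₃₁)

-- a₃ makes v = det (a_ij), which has weight 3 because Sym2 A has determinant (det A)³;
-- a₄ and a₆ are then forced by (i), through 24 b₄ = b₂² − c₄ and 216 b₆ = 36 b₂ b₄ − b₂³ − c₆.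
ξ η a₁ a₂ a₃ a₄ a₆ : Poly
ξ  = a₁₁ ⊗ a₃₃ ⊕ a₁₃ ⊗ a₃₁ ⊖ a₁₂ ⊗ a₃₂
η  = con 0
a₁ = a₂₂
a₂ = 2 ⊛ (a₁₂ ⊗ a₃₂) ⊖ (a₁₁ ⊗ a₃₃ ⊕ a₂₁ ⊗ a₂₃ ⊕ a₃₁ ⊗ a₁₃)
a₃ = det₃ ⊖ a₁ ⊗ ξ
a₄ = a₁₃ ⊗ a₂₂ ⊗ a₂₂ ⊗ a₃₁ ⊕ a₁₃ ⊗ a₂₁ ⊗ a₂₃ ⊗ a₃₁
   ⊖ a₁₃ ⊗ a₂₁ ⊗ a₂₂ ⊗ a₃₂ ⊕ a₁₃ ⊗ a₂₁ ⊗ a₂₁ ⊗ a₃₃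
   ⊖ a₁₂ ⊗ a₂₂ ⊗ a₂₃ ⊗ a₃₁ ⊖ a₁₂ ⊗ a₂₁ ⊗ a₂₃ ⊗ a₃₂
   ⊖ a₁₂ ⊗ a₁₃ ⊗ a₃₁ ⊗ a₃₂ ⊕ a₁₂ ⊗ a₁₂ ⊗ a₃₂ ⊗ a₃₂
   ⊕ a₁₂ ⊗ a₁₂ ⊗ a₃₁ ⊗ a₃₃ ⊕ a₁₁ ⊗ a₂₃ ⊗ a₂₃ ⊗ a₃₁
   ⊕ a₁₁ ⊗ a₂₁ ⊗ a₂₃ ⊗ a₃₃ ⊕ a₁₁ ⊗ a₁₃ ⊗ a₃₂ ⊗ a₃₂
   ⊖ 4 ⊛ (a₁₁ ⊗ a₁₃ ⊗ a₃₁ ⊗ a₃₃) ⊖ a₁₁ ⊗ a₁₂ ⊗ a₃₂ ⊗ a₃₃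
a₆ = ⊝ (a₁₃ ⊗ a₁₃ ⊗ a₂₂ ⊗ a₂₂ ⊗ a₃₁ ⊗ a₃₁) ⊕ a₁₃ ⊗ a₁₃ ⊗ a₂₁ ⊗ a₂₂ ⊗ a₃₁ ⊗ a₃₂
   ⊖ a₁₃ ⊗ a₁₃ ⊗ a₂₁ ⊗ a₂₁ ⊗ a₃₁ ⊗ a₃₃ ⊕ a₁₂ ⊗ a₁₃ ⊗ a₂₂ ⊗ a₂₃ ⊗ a₃₁ ⊗ a₃₁
   ⊕ a₁₂ ⊗ a₁₃ ⊗ a₂₂ ⊗ a₂₂ ⊗ a₃₁ ⊗ a₃₂ ⊖ a₁₂ ⊗ a₁₃ ⊗ a₂₁ ⊗ a₂₂ ⊗ a₃₂ ⊗ a₃₂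
   ⊕ a₁₂ ⊗ a₁₃ ⊗ a₂₁ ⊗ a₂₁ ⊗ a₃₂ ⊗ a₃₃ ⊖ a₁₂ ⊗ a₁₂ ⊗ a₂₂ ⊗ a₂₃ ⊗ a₃₁ ⊗ a₃₂
   ⊖ a₁₂ ⊗ a₁₂ ⊗ a₁₃ ⊗ a₃₁ ⊗ a₃₁ ⊗ a₃₃ ⊕ a₁₂ ⊗ a₁₂ ⊗ a₁₂ ⊗ a₃₁ ⊗ a₃₂ ⊗ a₃₃
   ⊖ a₁₁ ⊗ a₁₃ ⊗ a₂₃ ⊗ a₂₃ ⊗ a₃₁ ⊗ a₃₁ ⊖ a₁₁ ⊗ a₁₃ ⊗ a₂₂ ⊗ a₂₂ ⊗ a₃₁ ⊗ a₃₃
   ⊕ a₁₁ ⊗ a₁₃ ⊗ a₂₁ ⊗ a₂₂ ⊗ a₃₂ ⊗ a₃₃ ⊖ a₁₁ ⊗ a₁₃ ⊗ a₂₁ ⊗ a₂₁ ⊗ a₃₃ ⊗ a₃₃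
   ⊖ a₁₁ ⊗ a₁₃ ⊗ a₁₃ ⊗ a₃₁ ⊗ a₃₂ ⊗ a₃₂ ⊕ 4 ⊛ (a₁₁ ⊗ a₁₃ ⊗ a₁₃ ⊗ a₃₁ ⊗ a₃₁ ⊗ a₃₃)
   ⊕ a₁₁ ⊗ a₁₂ ⊗ a₂₃ ⊗ a₂₃ ⊗ a₃₁ ⊗ a₃₂ ⊕ a₁₁ ⊗ a₁₂ ⊗ a₂₂ ⊗ a₂₃ ⊗ a₃₁ ⊗ a₃₃
   ⊕ a₁₁ ⊗ a₁₂ ⊗ a₁₃ ⊗ a₃₂ ⊗ a₃₂ ⊗ a₃₂ ⊖ 4 ⊛ (a₁₁ ⊗ a₁₂ ⊗ a₁₃ ⊗ a₃₁ ⊗ a₃₂ ⊗ a₃₃)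
   ⊖ a₁₁ ⊗ a₁₂ ⊗ a₁₂ ⊗ a₃₁ ⊗ a₃₃ ⊗ a₃₃ ⊖ a₁₁ ⊗ a₁₁ ⊗ a₂₃ ⊗ a₂₃ ⊗ a₃₁ ⊗ a₃₃
   ⊖ a₁₁ ⊗ a₁₁ ⊗ a₁₃ ⊗ a₃₂ ⊗ a₃₂ ⊗ a₃₃ ⊕ 4 ⊛ (a₁₁ ⊗ a₁₁ ⊗ a₁₃ ⊗ a₃₁ ⊗ a₃₃ ⊗ a₃₃)

lemma2p1 : ∃ λ ξ → ∃ λ η → ∃ λ a1 → ∃ λ a2 → ∃ λ a3 → ∃ λ a4 → ∃ λ a6 →
    let b2 = a1 ^ 2 ⊕ 4 ⊛ a2
        b4 = a1 ⊗ a3 ⊕ 2 ⊛ a4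
        b6 = a3 ^ 2 ⊕ 4 ⊛ a6
        u = 12 ⊛ ξ ⊕ a1 ^ 2 ⊕ 4 ⊛ a2
        v = 2 ⊛ η ⊕ a1 ⊗ ξ ⊕ a3
    in ((c4 ≈ₚ b2 ^ 2 ⊖ 24 ⊛ b4)
        × (c6 ≈ₚ (⊝ (b2 ^ 3)) ⊕ 36 ⊛ (b2 ⊗ b4) ⊖ 216 ⊛ b6))
     × (Invariant 2 u × Invariant 3 v
        × ((108 ⊛ v) ^ 2 ≈ₚ (3 ⊛ u) ^ 3 ⊖ 27 ⊛ (c4 ⊗ (3 ⊛ u)) ⊖ 54 ⊛ c6))
     × (η ^ 2 ⊕ a1 ⊗ ξ ⊗ η ⊕ a3 ⊗ η ≈ₚ ξ ^ 3 ⊕ a2 ⊗ ξ ^ 2 ⊕ a4 ⊗ ξ ⊕ a6)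
lemma2p1 = ξ , η , a₁ , a₂ , a₃ , a₄ , a₆ ,
  ( ( ≈ₚ-by-normalisation c4 (b₂ ^ 2 ⊖ 24 ⊛ b₄) ≡.refl
    , ≈ₚ-by-normalisation c6 ((⊝ (b₂ ^ 3)) ⊕ 36 ⊛ (b₂ ⊗ b₄) ⊖ 216 ⊛ b₆) ≡.refl )
  , ( invariant-by-normalisation 2 u ≡.refl ≡.refl ≡.refl
    , invariant-by-normalisation 3 v ≡.refl ≡.refl ≡.refl
    , ≈ₚ-by-normalisation ((108 ⊛ v) ^ 2) ((3 ⊛ u) ^ 3 ⊖ 27 ⊛ (c4 ⊗ (3 ⊛ u)) ⊖ 54 ⊛ c6) ≡.refl )
  , ≈ₚ-by-normalisation (η ^ 2 ⊕ a₁ ⊗ ξ ⊗ η ⊕ a₃ ⊗ η) (ξ ^ 3 ⊕ a₂ ⊗ ξ ^ 2 ⊕ a₄ ⊗ ξ ⊕ a₆) ≡.refl )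
  where
  b₂ = a₁ ^ 2 ⊕ 4 ⊛ a₂
  b₄ = a₁ ⊗ a₃ ⊕ 2 ⊛ a₄
  b₆ = a₃ ^ 2 ⊕ 4 ⊛ a₆
  u  = 12 ⊛ ξ ⊕ a₁ ^ 2 ⊕ 4 ⊛ a₂
  v  = 2 ⊛ η ⊕ a₁ ⊗ ξ ⊕ a₃
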